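{- Let $\alpha\ge 5/3$. Let $G$ be an instance of MAP that is 2-node connected, and let $C$ be an S$\{3,4\}$ of $G$. Let $\hat v$ be the contracted node of $G/V(C)$, and let $B_1,\dots,B_k$ be the 2ec-$\hat v$-blocks of $G/V(C)$. Let $B'_1,\dots,B'_k$ be 2-ECSSs of $B_1,\dots,B_k$, respectively, with $\mathrm{cost}(B'_i)\le\max(\mathrm{opt}(B_i),\ \alpha\,\mathrm{opt}(B_i)-2)$ for all $i\in[k]$. Let $\hat C$ be a spanning cycle of $C$ of cost two. Then $E(\hat C)\cup E(B'_1)\cup\dots\cup E(B'_k)$ is the edge set of a 2-ECSS of $G$ of cost at most $\max(\mathrm{opt}(G),\ \alpha\,\mathrm{opt}(G)-2)$.
   Context: An instance of MAP is a loop-free, 2-edge connected multigraph $G$ with edge costs in $\{0,1\}$ whose cost-$0$ edges ("zero-edges") form a matching. A graph is 2-edge connected if it has at least $2$ nodes and is connected after deleting any single edge. It is 2-node connected (2NC) if it has at least $3$ nodes and is connected after deleting any single node. A 2-ECSS is a 2-edge connected spanning subgraph, and $\mathrm{opt}(\cdot)$ is its minimum cost. $G/S$ identifies the nodes of $S$ into a node $\hat v$ and deletes the edges inside $S$; its edges are identified with those of $G$. For a cut node $w$ of a 2-edge connected graph $M$, a 2ec-$w$-block is the subgraph induced by $\{w\}\cup V(D)$ for a component $D$ of $M-w$. The cut $\delta(S)$ is the set of edges with exactly one end in $S$. An S$\{3,4\}$ of $G$ is an induced 2NC subgraph $C$ with $|V(C)|\in\{3,4\}$ satisfying all of the following. It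 has a spanning cycle of cost $2$. The graph $G-V(C)$ has at least $2$ components. The cut $\delta(V(C))$ contains no zero-edge. In $G/V(C)$ there exist two distinct 2ec-$\hat v$-blocks $B_1,B_2$ with $\mathrm{opt}(B_1)\ge3$ and $\mathrm{opt}(B_2)\ge3$.
   Formalization: The parameter α ranges over the rationals with α ≥ 5/3 rather than over the reals. -}

module Defs where

open import Data.Nat using (ℕ; zero; suc; _+_; _≤_)
open import Data.Nat.DivMod using (_%_; m%n<n)
open import Data.Fin using (Fin; zero; suc; toℕ; fromℕ<; _≟_)
open import Data.Bool using (Bool; true; false; _∧_; _∨_; not; if_then_else_)
open import Data.Product using (Σ; _×_; _,_; proj₁; proj₂; ∃)
open import Data.Sum using (_⊎_)
open import Relation.Binary.PropositionalEquality using (_≡_; _≢_)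
open import Relation.Nullary.Decidable using (⌊_⌋)
open import Function using (_∘_)
open import Data.Integer using (+_)
import Data.Rational as Q

sumFin : {k : ℕ} → (Fin k → ℕ) → ℕ
sumFin {zero}  f = 0
sumFin {suc k} f = f zero + sumFin (f ∘ suc)

anyFin : {k : ℕ} → (Fin k → Bool) → Bool
anyFin {zero}  f = false
anyFin {suc k} f = f zero ∨ anyFin (f ∘ suc)

-- A (multi)graph, given as a node set V ⊆ Fin n and an edge set
-- E ⊆ Fin m over ambient edge "names" Fin m with endpoints and costs.
-- Subgraphs / contractions keep the same edge names, so edges of
-- derived graphs are identified with edges of the original graph.

record Graph : Set where
  field
    n    : ℕ
    m    : ℕ
    ends : Fin m → Fin n × Fin n
    cost : Fin m → ℕ
    V    : Fin n → Bool
    E    : Fin m → Bool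
open Graph public

end₁ end₂ : (H : Graph) → Fin (m H) → Fin (n H)
end₁ H e = proj₁ (ends H e)
end₂ H e = proj₂ (ends H e)

WF : Graph → Set
WF H = ∀ e → E H e ≡ true → (V H (end₁ H e) ≡ true) × (V H (end₂ H e) ≡ true)

Joins : (H : Graph) → Fin (m H) → Fin (n H) → Fin (n H) → Set
Joins H e u v = (ends H e ≡ (u , v)) ⊎ (ends H e ≡ (v , u))

data Reach (H : Graph) : Fin (n H) → Fin (n H) → Set where
  here : ∀ {u} → Reach H u u
  step : ∀ {u v w} (e : Fin (m H)) → E H e ≡ true → Joins H e u v →
         Reach H v w → Reach H u w

Connected : Graph → Set
Connected H = ∀ u v → V H u ≡ true → V H v ≡ true → Reach H u v

nodeCount : Graph → ℕ
nodeCount H = sumFin (λ v → if V H v then 1 else 0)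

costOf : (H : Graph) → (Fin (m H) → Bool) → ℕ
costOf H F = sumFin (λ e → if F e then cost H e else 0)

costG : Graph → ℕ
costG H = costOf H (E H)

withE : (H : Graph) → (Fin (m H) → Bool) → Graph
withE H F = record H { E = F }

deleteEdge : (H : Graph) → Fin (m H) → Graph
deleteEdge H e = withE H (λ f → E H f ∧ not ⌊ f ≟ e ⌋)

deleteNode : (H : Graph) → Fin (n H) → Graph
deleteNode H w = record H
  { V = λ v → V H v ∧ not ⌊ v ≟ w ⌋
  ; E = λ e → E H e ∧ not ⌊ end₁ H e ≟ w ⌋ ∧ not ⌊ end₂ H e ≟ w ⌋ }

deleteNodes : (H : Graph) → (Fin (n H) → Bool) → Graph
deleteNodes H S = record H
  { V = λ v → V H v ∧ not (S v)
  ; E = λ e → E H e ∧ not (S (end₁ H e)) ∧ not (S (end₂ H e)) }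

induced : (H : Graph) → (Fin (n H) → Bool) → Graph
induced H S = record H
  { V = λ v → V H v ∧ S v
  ; E = λ e → E H e ∧ S (end₁ H e) ∧ S (end₂ H e) }

TwoEC : Graph → Set
TwoEC H = (2 ≤ nodeCount H) × Connected H ×
          (∀ e → E H e ≡ true → Connected (deleteEdge H e))

TwoNC : Graph → Set
TwoNC H = (3 ≤ nodeCount H) × Connected H ×
          (∀ w → V H w ≡ true → Connected (deleteNode H w))

IsECSS : (H : Graph) → (Fin (m H) → Bool) → Set
IsECSS H F = (∀ e → F e ≡ true → E H e ≡ true) × TwoEC (withE H F)

IsOpt : Graph → ℕ → Set
IsOpt H o = (Σ (Fin (m H) → Bool) λ F → IsECSS H F × costOf H F ≡ o) ×
            (∀ F → IsECSS H F → o ≤ costOf H F)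

MAP : Graph → Set
MAP H = WF H
      × (∀ e → E H e ≡ true → end₁ H e ≢ end₂ H e)
      × TwoEC H
      × (∀ e → E H e ≡ true → cost H e ≤ 1)
      × (∀ e f → E H e ≡ true → E H f ≡ true → e ≢ f →           -- zero-edges
           cost H e ≡ 0 → cost H f ≡ 0 → (u : Fin (n H)) →       -- form a matching
           ¬Inc H e u ⊎ ¬Inc H f u)
  where
    ¬Inc : (H : Graph) → Fin (m H) → Fin (n H) → Set
    ¬Inc H e u = (end₁ H e ≢ u) × (end₂ H e ≢ u)

IsComponent : (H : Graph) → (Fin (n H) → Bool) → Set
IsComponent H D = (∀ v → D v ≡ true → V H v ≡ true)
                × (∃ λ v → D v ≡ true)
                × Connected (induced H D)
                × (∀ e → E H e ≡ true →
                     (D (end₁ H e) ≡ true → D (end₂ H e) ≡ true) ×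
                     (D (end₂ H e) ≡ true → D (end₁ H e) ≡ true))

SameSet : {k : ℕ} → (Fin k → Bool) → (Fin k → Bool) → Set
SameSet A B = ∀ v → A v ≡ B v

-- Contraction G/S: nodes of S identified into v̂ = zero; other nodes v
-- become suc v; edges inside S deleted; edge names kept.

contract : (H : Graph) → (Fin (n H) → Bool) → Graph
contract H S = record
  { n    = suc (n H)
  ; m    = m H
  ; ends = λ e → f (end₁ H e) , f (end₂ H e)
  ; cost = cost H
  ; V    = λ { zero → true ; (suc v) → V H v ∧ not (S v) }
  ; E    = λ e → E H e ∧ not (S (end₁ H e) ∧ S (end₂ H e)) }
  where
    f : Fin (n H) → Fin (suc (n H))
    f v = if S v then zero else suc v

-- 2ec-w-block of M for the component D of M - w
block : (M : Graph) → Fin (n M) → (Fin (n M) → Bool) → Graph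
block M w D = induced M (λ v → ⌊ v ≟ w ⌋ ∨ D v)

-- D enumerates (without repetition) exactly the components of M - w,
-- so block M w (D i), i : Fin k, are exactly the 2ec-w-blocks of M
BlockEnum : (M : Graph) → Fin (n M) → {k : ℕ} → (Fin k → Fin (n M) → Bool) → Set
BlockEnum M w {k} D =
    (∀ i → IsComponent (deleteNode M w) (D i))
  × (∀ i j → SameSet (D i) (D j) → i ≡ j)
  × (∀ D′ → IsComponent (deleteNode M w) D′ → Σ (Fin k) λ i → SameSet D′ (D i))

next : {k : ℕ} → Fin (suc k) → Fin (suc k)
next {k} i = fromℕ< (m%n<n (suc (toℕ i)) (suc k))

SpanningCycle : (H : Graph) → (Fin (m H) → Bool) → Set
SpanningCycle H F =
  Σ ℕ λ k → Σ (Fin (suc k) → Fin (n H)) λ cv → Σ (Fin (suc k) → Fin (m H)) λ ce →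
      (1 ≤ k)
    × (∀ i j → cv i ≡ cv j → i ≡ j)
    × (∀ i → V H (cv i) ≡ true)
    × (∀ v → V H v ≡ true → Σ (Fin (suc k)) λ i → cv i ≡ v)
    × (∀ i j → ce i ≡ ce j → i ≡ j)
    × (∀ i → E H (ce i) ≡ true)
    × (∀ i → Joins H (ce i) (cv i) (cv (next i)))
    × (∀ e → F e ≡ true → Σ (Fin (suc k)) λ i → ce i ≡ e)
    × (∀ i → F (ce i) ≡ true)

ℕ→ℚ : ℕ → Q.ℚ
ℕ→ℚ k = + k Q./ 1

bound : Q.ℚ → ℕ → Q.ℚ
bound α o = ℕ→ℚ o Q.⊔ (α Q.* ℕ→ℚ o Q.- ℕ→ℚ 2)

OptAtLeast3 : Graph → Set
OptAtLeast3 H = ∀ o → IsOpt H o → 3 ≤ o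

IsS34 : (G : Graph) → (Fin (n G) → Bool) → Set
IsS34 G SC =
    (∀ v → SC v ≡ true → V G v ≡ true)
  × TwoNC (induced G SC)
  × ((nodeCount (induced G SC) ≡ 3) ⊎ (nodeCount (induced G SC) ≡ 4))
  × (Σ (Fin (m G) → Bool) λ F → SpanningCycle (induced G SC) F × costOf G F ≡ 2)
  × (Σ (Fin (n G) → Bool) λ D₁ → Σ (Fin (n G) → Bool) λ D₂ →
        IsComponent (deleteNodes G SC) D₁ × IsComponent (deleteNodes G SC) D₂ ×
        (SameSet D₁ D₂ → ⊥′))
  × (∀ e → E G e ≡ true → SC (end₁ G e) ≢ SC (end₂ G e) → cost G e ≢ 0)
  × (Σ (Fin (suc (n G)) → Bool) λ D₁ → Σ (Fin (suc (n G)) → Bool) λ D₂ →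
        IsComponent (deleteNode (contract G SC) zero) D₁ ×
        IsComponent (deleteNode (contract G SC) zero) D₂ ×
        (SameSet D₁ D₂ → ⊥′) ×
        OptAtLeast3 (block (contract G SC) zero D₁) ×
        OptAtLeast3 (block (contract G SC) zero D₂))
  where open import Data.Empty renaming (⊥ to ⊥′)

module Submission where

-- 2-edge connectivity: after deleting any edge e, every node of C still
-- reaches a fixed node of C along the cycle, and every other node lies
-- in some block, where its walk to v̂ avoiding e lifts to a walk of G
-- into C (union-connected, union-ECSS).
--
-- Cost: restricting an optimal 2-ECSS of G to the edge-disjoint blocks
-- gives Σ opt(B i) ≤ opt(G) (blocks-opt-sum).  Each F i costs at most
-- α·opt(B i), and the two blocks with opt ≥ 3 that an S{3,4} provides
-- cost at most α·opt − 2; these two savings of 2 pay for cost(Ĉ) = 2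
-- and for the "− 2" of the bound (accounting).  Optima exist only
-- classically, which is harmless as the final inequality is decidable.

open import Defs
open import Data.Fin using (Fin)
open import Data.Bool using (Bool)

module Booleans where
  open import Data.Nat using (zero; suc)
  open import Data.Fin using (Fin; zero; suc; _≟_)
  open import Data.Bool using (Bool; true; false; _∧_; _∨_; not)
  open import Data.Bool.Properties using (∧-conicalˡ; ∧-conicalʳ; ∨-zeroʳ)
  open import Data.Product using (Σ; _×_; _,_)
  open import Data.Sum using (_⊎_; inj₁; inj₂)
  open import Relation.Nullary using (Dec; yes; no; contradiction)
  open import Relation.Nullary.Decidable using (⌊_⌋)
  open import Relation.Binary.PropositionalEquality using (_≡_; _≢_; refl)
  open import Function using (_∘_)

  false≢true : false ≢ true
  false≢true ()

  ∧-elim : ∀ {x y} → x ∧ y ≡ true → x ≡ true × y ≡ true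
  ∧-elim {x} {y} h = ∧-conicalˡ x y h , ∧-conicalʳ x y h

  ∧-intro : ∀ {x y} → x ≡ true → y ≡ true → x ∧ y ≡ true
  ∧-intro refl refl = refl

  ∨-elim : ∀ {x y} → x ∨ y ≡ true → x ≡ true ⊎ y ≡ true
  ∨-elim {true}  _ = inj₁ refl
  ∨-elim {false} h = inj₂ h

  ∨-introˡ : ∀ {x} y → x ≡ true → x ∨ y ≡ true
  ∨-introˡ y refl = refl

  ∨-introʳ : ∀ x {y} → y ≡ true → x ∨ y ≡ true
  ∨-introʳ x refl = ∨-zeroʳ x

  -- "not both": how the contraction records that an edge is not inside S
  not-both : ∀ {p q} → p ≡ false ⊎ q ≡ false → not (p ∧ q) ≡ true
  not-both {false} _ = refl
  not-both {true} {false} _ = refl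
  not-both {true} {true} (inj₁ ())
  not-both {true} {true} (inj₂ ())

  not-both⁻ : ∀ {p q} → not (p ∧ q) ≡ true → p ≡ false ⊎ q ≡ false
  not-both⁻ {false} _ = inj₁ refl
  not-both⁻ {true} {false} _ = inj₂ refl

  anyFin-elim : ∀ {k} (g : Fin k → Bool) → anyFin g ≡ true → Σ (Fin k) λ i → g i ≡ true
  anyFin-elim {suc k} g h with ∨-elim {g zero} h
  ... | inj₁ g0 = zero , g0
  ... | inj₂ gs with anyFin-elim (g ∘ suc) gs
  ...   | i , gi = suc i , gi

  anyFin-intro : ∀ {k} (g : Fin k → Bool) i → g i ≡ true → anyFin g ≡ true
  anyFin-intro g zero    h = ∨-introˡ _ h
  anyFin-intro g (suc i) h = ∨-introʳ (g zero) (anyFin-intro (g ∘ suc) i h)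

  ⌊⌋-intro : ∀ {P : Set} (d : Dec P) → P → ⌊ d ⌋ ≡ true
  ⌊⌋-intro (yes _) _ = refl
  ⌊⌋-intro (no ¬p) p = contradiction p ¬p

  ⌊⌋-elim : ∀ {P : Set} (d : Dec P) → ⌊ d ⌋ ≡ true → P
  ⌊⌋-elim (yes p) _ = p

  ≟-distinct : ∀ {k} {i j : Fin k} → i ≢ j → not ⌊ i ≟ j ⌋ ≡ true
  ≟-distinct {i = i} {j} i≢j with i ≟ j
  ... | yes i≡j = contradiction i≡j i≢j
  ... | no _    = refl

module FiniteSums where
  open import Data.Nat using (ℕ; zero; suc; _+_; _≤_; z≤n)
  open import Data.Nat.Properties
    using (+-mono-≤; +-monoʳ-≤; m≤m+n; m≤n+m; ≤-trans; ≤-refl; ≤-reflexive; +-comm; +-identityʳ)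
  open import Data.Nat.Solver using (module +-*-Solver)
  open import Data.Fin using (Fin; zero; suc)
  open import Data.Fin.Properties using (suc-injective)
  open import Data.Bool using (Bool; true; false; _∨_; if_then_else_)
  open import Relation.Binary.PropositionalEquality
  open import Relation.Nullary using (contradiction)
  open import Function using (_∘_)
  open Booleans using (false≢true)

  sumFin-mono : ∀ {k} (f g : Fin k → ℕ) → (∀ i → f i ≤ g i) → sumFin f ≤ sumFin g
  sumFin-mono {zero}  f g h = z≤n
  sumFin-mono {suc k} f g h = +-mono-≤ (h zero) (sumFin-mono (f ∘ suc) (g ∘ suc) (h ∘ suc))

  sumFin-zero : ∀ {k} (f : Fin k → ℕ) → (∀ i → f i ≡ 0) → sumFin f ≡ 0
  sumFin-zero {zero}  f h = refl
  sumFin-zero {suc k} f h rewrite h zero = sumFin-zero (f ∘ suc) (h ∘ suc)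

  sumFin-+ : ∀ {k} (f g : Fin k → ℕ) → sumFin (λ i → f i + g i) ≡ sumFin f + sumFin g
  sumFin-+ {zero}  f g = refl
  sumFin-+ {suc k} f g rewrite sumFin-+ (f ∘ suc) (g ∘ suc) =
    solve 4 (λ a b c d → (a :+ b) :+ (c :+ d) := (a :+ c) :+ (b :+ d)) refl
      (f zero) (g zero) (sumFin (f ∘ suc)) (sumFin (g ∘ suc))
    where open +-*-Solver

  sumFin-swap : ∀ {k l} (h : Fin k → Fin l → ℕ) →
    sumFin (λ i → sumFin (h i)) ≡ sumFin (λ j → sumFin (λ i → h i j))
  sumFin-swap {zero}  {l} h = sym (sumFin-zero {l} (λ _ → 0) (λ _ → refl))
  sumFin-swap {suc k} {l} h rewrite sumFin-swap (h ∘ suc) =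
    sym (sumFin-+ (h zero) (λ j → sumFin (λ i → h (suc i) j)))

  sumFin-term : ∀ {k} (f : Fin k → ℕ) i → f i ≤ sumFin f
  sumFin-term f zero    = m≤m+n _ _
  sumFin-term f (suc i) = ≤-trans (sumFin-term (f ∘ suc) i) (m≤n+m _ _)

  sumFin-pair : ∀ {k} (f : Fin k → ℕ) i j → i ≢ j → f i + f j ≤ sumFin f
  sumFin-pair f zero    zero    i≢j = contradiction refl i≢j
  sumFin-pair f zero    (suc j) _   = +-monoʳ-≤ (f zero) (sumFin-term (f ∘ suc) j)
  sumFin-pair f (suc i) zero    _   =
    subst (_≤ sumFin f) (+-comm (f zero) (f (suc i))) (sumFin-pair f zero (suc i) λ ())
  sumFin-pair f (suc i) (suc j) i≢j =
    ≤-trans (sumFin-pair (f ∘ suc) i j (i≢j ∘ cong suc)) (m≤n+m _ (f zero))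

  sumFin-atMostOne : ∀ {k} (A : Fin k → Bool) (c : ℕ) →
    (∀ i j → A i ≡ true → A j ≡ true → i ≡ j) →
    sumFin (λ i → if A i then c else 0) ≤ c
  sumFin-atMostOne {zero}  A c _ = z≤n
  sumFin-atMostOne {suc k} A c unique with A zero in A0
  ... | true  = ≤-reflexive (trans (cong (c +_) (sumFin-zero _ rest-zero)) (+-identityʳ c))
    where
    rest-zero : ∀ i → (if A (suc i) then c else 0) ≡ 0
    rest-zero i with A (suc i) in Ai
    ... | true with () ← unique zero (suc i) A0 Ai
    ... | false = refl
  ... | false = sumFin-atMostOne (A ∘ suc) c λ i j p q → suc-injective (unique (suc i) (suc j) p q)

  costOf-∨ : (H : Graph) (A B : Fin (m H) → Bool) →
    costOf H (λ e → A e ∨ B e) ≤ costOf H A + costOf H B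
  costOf-∨ H A B = ≤-trans (sumFin-mono _ _ pointwise) (≤-reflexive (sumFin-+ (term A) (term B)))
    where
    term : (Fin (m H) → Bool) → Fin (m H) → ℕ
    term X e = if X e then cost H e else 0
    pointwise : ∀ e → term (λ f → A f ∨ B f) e ≤ term A e + term B e
    pointwise e with A e
    ... | true  = m≤m+n _ _
    ... | false = ≤-refl

  costOf-anyFin : (H : Graph) {k : ℕ} (F : Fin k → Fin (m H) → Bool) →
    costOf H (λ e → anyFin (λ i → F i e)) ≤ sumFin (λ i → costOf H (F i))
  costOf-anyFin H {zero}  F = ≤-reflexive (sumFin-zero {m H} _ λ _ → refl)
  costOf-anyFin H {suc k} F =
    ≤-trans (costOf-∨ H (F zero) (λ e → anyFin (λ i → F (suc i) e)))
            (+-monoʳ-≤ (costOf H (F zero)) (costOf-anyFin H (F ∘ suc)))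

  costOf-disjoint : (H : Graph) {k : ℕ} (A : Fin k → Fin (m H) → Bool) (S : Fin (m H) → Bool) →
    (∀ e i j → A i e ≡ true → A j e ≡ true → i ≡ j) → (∀ i e → A i e ≡ true → S e ≡ true) →
    sumFin (λ i → costOf H (A i)) ≤ costOf H S
  costOf-disjoint H A S disjoint A⊆S =
    ≤-trans (≤-reflexive (sumFin-swap (λ i e → if A i e then cost H e else 0)))
            (sumFin-mono _ _ per-edge)
    where
    per-edge : ∀ e → sumFin (λ i → if A i e then cost H e else 0) ≤ (if S e then cost H e else 0)
    per-edge e with S e in Se
    ... | true  = sumFin-atMostOne (λ i → A i e) (cost H e) (disjoint e)
    ... | false = ≤-reflexive (sumFin-zero _ outside)
      where
      outside : ∀ i → (if A i e then cost H e else 0) ≡ 0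
      outside i with A i e in Aie
      ... | true  = contradiction (trans (sym Se) (A⊆S i e Aie)) false≢true
      ... | false = refl

  count-two : ∀ {k} (g : Fin k → Bool) a b → a ≢ b → g a ≡ true → g b ≡ true →
    2 ≤ sumFin (λ v → if g v then 1 else 0)
  count-two g a b a≢b ga gb =
    subst (_≤ sumFin (λ v → if g v then 1 else 0))
      (cong₂ _+_ (cong (λ z → if z then 1 else 0) ga) (cong (λ z → if z then 1 else 0) gb))
      (sumFin-pair (λ v → if g v then 1 else 0) a b a≢b)

module RationalBounds where
  open import Data.Nat as ℕ using (ℕ; zero; suc; z≤n; s≤s)
  open import Data.Nat.Properties as ℕP using (m≤n⇒∃[o]m+o≡n)
  open import Data.Nat.Coprimality using (1-coprimeTo; sym)
  open import Data.Fin using (Fin; zero; suc; _≟_)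
  open import Data.Integer as ℤ using (+_)
  import Data.Integer.Properties as ℤP
  open import Data.Rational using (ℚ; mkℚ; _/_; _+_; _-_; _*_; -_; _≤_; *≤*; 0ℚ; 1ℚ; NonNegative; nonNegative)
  open import Data.Rational.Properties hiding (_≟_)
  open import Data.Rational.Solver using (module +-*-Solver)
  open import Data.Bool using (if_then_else_; _∨_)
  open import Data.Product using (_,_)
  open import Relation.Nullary using (yes; no)
  open import Relation.Nullary.Decidable using (⌊_⌋)
  open import Relation.Binary.PropositionalEquality as Eq using (_≡_; _≢_; refl; cong; cong₂; subst; subst₂)
  open import Function using (_∘_)
  open FiniteSums using (sumFin-pair; sumFin-+)
  open Booleans using (⌊⌋-intro)
  open import Data.Bool.Properties using (∨-zeroʳ)

  k/1 : ℕ → ℚ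
  k/1 k = mkℚ (+ k) 0 (sym (1-coprimeTo k))

  ℕ→ℚ-mkℚ : ∀ k → ℕ→ℚ k ≡ k/1 k
  ℕ→ℚ-mkℚ k = normalize-coprime (sym (1-coprimeTo k))

  ℕ→ℚ-+ : ∀ a b → ℕ→ℚ (a ℕ.+ b) ≡ ℕ→ℚ a + ℕ→ℚ b
  ℕ→ℚ-+ a b = Eq.trans sum-as-fraction
    (Eq.sym (cong₂ _+_ (ℕ→ℚ-mkℚ a) (ℕ→ℚ-mkℚ b)))
    where
    sum-as-fraction : ℕ→ℚ (a ℕ.+ b) ≡ k/1 a + k/1 b
    sum-as-fraction = /-cong {p₁ = + (a ℕ.+ b)}
      (Eq.sym (cong₂ ℤ._+_ (ℤP.*-identityʳ (+ a)) (ℤP.*-identityʳ (+ b)))) refl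

  ℕ→ℚ-mono : ∀ {a b} → a ℕ.≤ b → ℕ→ℚ a ≤ ℕ→ℚ b
  ℕ→ℚ-mono {a} {b} a≤b = subst₂ _≤_ (Eq.sym (ℕ→ℚ-mkℚ a)) (Eq.sym (ℕ→ℚ-mkℚ b))
    (*≤* (subst₂ ℤ._≤_ (Eq.sym (ℤP.*-identityʳ (+ a))) (Eq.sym (ℤP.*-identityʳ (+ b))) (ℤ.+≤+ a≤b)))

  ℕ→ℚ-nonNeg : ∀ k → NonNegative (ℕ→ℚ k)
  ℕ→ℚ-nonNeg k = nonNegative (ℕ→ℚ-mono {0} {k} z≤n)

  5/3 : ℚ
  5/3 = + 5 / 3

  α-nonNeg : ∀ {α} → 5/3 ≤ α → NonNegative α
  α-nonNeg 5/3≤α = nonNegative (≤-trans (<⇒≤ (positive⁻¹ 5/3)) 5/3≤α)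

  o≤α*o : ∀ {α} → 5/3 ≤ α → ∀ o → ℕ→ℚ o ≤ α * ℕ→ℚ o
  o≤α*o {α} 5/3≤α o = begin
    ℕ→ℚ o          ≡⟨ Eq.sym (*-identityˡ _) ⟩
    1ℚ * ℕ→ℚ o     ≤⟨ *-monoʳ-≤-nonNeg (ℕ→ℚ o) {{ℕ→ℚ-nonNeg o}} 1≤α ⟩
    α * ℕ→ℚ o      ∎
    where
    open ≤-Reasoning
    1≤α : 1ℚ ≤ α
    1≤α = ≤-trans (*≤* (ℤ.+≤+ (s≤s (s≤s (s≤s z≤n))))) 5/3≤α

  o+2≤5/3*o : ∀ o → 3 ℕ.≤ o → ℕ→ℚ o + ℕ→ℚ 2 ≤ 5/3 * ℕ→ℚ o
  o+2≤5/3*o o 3≤o with m≤n⇒∃[o]m+o≡n 3≤o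
  ... | d , refl = begin
    ℕ→ℚ (3 ℕ.+ d) + ℕ→ℚ 2                     ≡⟨ cong (_+ ℕ→ℚ 2) (ℕ→ℚ-+ 3 d) ⟩
    (ℕ→ℚ 3 + ℕ→ℚ d) + ℕ→ℚ 2                   ≡⟨ Eq.sym (+-identityʳ _) ⟩
    (ℕ→ℚ 3 + ℕ→ℚ d) + ℕ→ℚ 2 + 0ℚ              ≤⟨ +-monoʳ-≤ ((ℕ→ℚ 3 + ℕ→ℚ d) + ℕ→ℚ 2) 0≤2/3*d ⟩
    (ℕ→ℚ 3 + ℕ→ℚ d) + ℕ→ℚ 2 + 2/3 * ℕ→ℚ d     ≡⟨ solve 1 (λ x → (con (ℕ→ℚ 3) :+ x) :+ con (ℕ→ℚ 2) :+ con 2/3 :* x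
                                                          := con 5/3 :* (con (ℕ→ℚ 3) :+ x)) refl (ℕ→ℚ d) ⟩
    5/3 * (ℕ→ℚ 3 + ℕ→ℚ d)                     ≡⟨ cong (5/3 *_) (Eq.sym (ℕ→ℚ-+ 3 d)) ⟩
    5/3 * ℕ→ℚ (3 ℕ.+ d)                       ∎
    where
    open ≤-Reasoning
    open +-*-Solver
    2/3 : ℚ
    2/3 = + 2 / 3
    0≤2/3*d : 0ℚ ≤ 2/3 * ℕ→ℚ d
    0≤2/3*d = nonNegative⁻¹ _ {{nonNeg*nonNeg⇒nonNeg 2/3 (ℕ→ℚ d) {{ℕ→ℚ-nonNeg d}}}}

  +2≤⇒≤-2 : ∀ {x y} → x + ℕ→ℚ 2 ≤ y → x ≤ y - ℕ→ℚ 2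
  +2≤⇒≤-2 {x} {y} h = begin
    x                        ≡⟨ solve 1 (λ z → z := z :+ con (ℕ→ℚ 2) :- con (ℕ→ℚ 2)) refl x ⟩
    x + ℕ→ℚ 2 - ℕ→ℚ 2        ≤⟨ +-monoˡ-≤ (- ℕ→ℚ 2) h ⟩
    y - ℕ→ℚ 2                ∎
    where open ≤-Reasoning
          open +-*-Solver

  ≤-2⇒+2≤ : ∀ {x y} → x ≤ y - ℕ→ℚ 2 → x + ℕ→ℚ 2 ≤ y
  ≤-2⇒+2≤ {x} {y} h = begin
    x + ℕ→ℚ 2                ≤⟨ +-monoˡ-≤ (ℕ→ℚ 2) h ⟩
    y - ℕ→ℚ 2 + ℕ→ℚ 2        ≡⟨ solve 1 (λ z → z :- con (ℕ→ℚ 2) :+ con (ℕ→ℚ 2) := z) refl y ⟩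
    y                        ∎
    where open ≤-Reasoning
          open +-*-Solver

  y-2≤y : ∀ y → y - ℕ→ℚ 2 ≤ y
  y-2≤y y = begin
    y - ℕ→ℚ 2      ≤⟨ +-monoʳ-≤ y (neg-antimono-≤ (ℕ→ℚ-mono {0} {2} z≤n)) ⟩
    y - 0ℚ         ≡⟨ +-identityʳ y ⟩
    y              ∎
    where open ≤-Reasoning

  -- bound α o ≤ α·o, because α ≥ 1
  bound≤α*o : ∀ {α} → 5/3 ≤ α → ∀ o → bound α o ≤ α * ℕ→ℚ o
  bound≤α*o {α} 5/3≤α o = ⊔-lub (o≤α*o 5/3≤α o) (y-2≤y (α * ℕ→ℚ o))

  -- bound α o = α·o − 2 once o ≥ 3, because then o + 2 ≤ (5/3)·o ≤ α·o
  bound+2≤α*o : ∀ {α} → 5/3 ≤ α → ∀ o → 3 ℕ.≤ o → bound α o + ℕ→ℚ 2 ≤ α * ℕ→ℚ o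
  bound+2≤α*o {α} 5/3≤α o 3≤o = ≤-2⇒+2≤ (⊔-lub o≤α*o-2 ≤-refl)
    where
    o≤α*o-2 : ℕ→ℚ o ≤ α * ℕ→ℚ o - ℕ→ℚ 2
    o≤α*o-2 = +2≤⇒≤-2 (≤-trans (o+2≤5/3*o o 3≤o)
                               (*-monoʳ-≤-nonNeg (ℕ→ℚ o) {{ℕ→ℚ-nonNeg o}} 5/3≤α))

  ≤α*o-2⇒≤bound : ∀ α x o → ℕ→ℚ x + ℕ→ℚ 2 ≤ α * ℕ→ℚ o → ℕ→ℚ x ≤ bound α o
  ≤α*o-2⇒≤bound α x o h = ≤-trans (+2≤⇒≤-2 h) (p≤q⊔p (ℕ→ℚ o) (α * ℕ→ℚ o - ℕ→ℚ 2))

  sum-scaled : ∀ α → NonNegative α → ∀ {k} (c o : Fin k → ℕ) →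
    (∀ i → ℕ→ℚ (c i) ≤ α * ℕ→ℚ (o i)) → ℕ→ℚ (sumFin c) ≤ α * ℕ→ℚ (sumFin o)
  sum-scaled α α≥0 {zero}  c o _ = nonNegative⁻¹ (α * 0ℚ) {{nonNeg*nonNeg⇒nonNeg α {{α≥0}} 0ℚ}}
  sum-scaled α α≥0 {suc k} c o h = begin
    ℕ→ℚ (c zero ℕ.+ sumFin (c ∘ suc))               ≡⟨ ℕ→ℚ-+ (c zero) _ ⟩
    ℕ→ℚ (c zero) + ℕ→ℚ (sumFin (c ∘ suc))           ≤⟨ +-mono-≤ (h zero) (sum-scaled α α≥0 (c ∘ suc) (o ∘ suc) (h ∘ suc)) ⟩
    α * ℕ→ℚ (o zero) + α * ℕ→ℚ (sumFin (o ∘ suc))   ≡⟨ Eq.sym (*-distribˡ-+ α _ _) ⟩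
    α * (ℕ→ℚ (o zero) + ℕ→ℚ (sumFin (o ∘ suc)))     ≡⟨ cong (α *_) (Eq.sym (ℕ→ℚ-+ (o zero) _)) ⟩
    α * ℕ→ℚ (o zero ℕ.+ sumFin (o ∘ suc))           ∎
    where open ≤-Reasoning

  -- Block i is bought at cost
  -- c i ≤ bound α (o i), where o i is its optimum; two distinct blocks
  -- have o ≥ 3, so each of them costs at most α·o − 2 and saves 2
  -- against α·o.  These two savings pay for the cycle (cost 2) and for
  -- the "− 2" of the bound, provided the optima add up to at most O.
  accounting : ∀ {α} → 5/3 ≤ α → ∀ {k} (c o : Fin k → ℕ) (i₁ i₂ : Fin k) → i₁ ≢ i₂ →
    3 ℕ.≤ o i₁ → 3 ℕ.≤ o i₂ → (∀ i → ℕ→ℚ (c i) ≤ bound α (o i)) →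
    ∀ x O → x ℕ.≤ 2 ℕ.+ sumFin c → sumFin o ℕ.≤ O → ℕ→ℚ x ≤ bound α O
  accounting {α} 5/3≤α {k} c o i₁ i₂ i₁≢i₂ large₁ large₂ per-block x O x≤2+Σc Σo≤O =
    ≤α*o-2⇒≤bound α x O x+2≤α*O
    where
    α≥0 : NonNegative α
    α≥0 = α-nonNeg 5/3≤α

    saving : Fin k → ℕ
    saving i = if ⌊ i ≟ i₁ ⌋ ∨ ⌊ i ≟ i₂ ⌋ then 2 else 0

    large-block : ∀ i → 3 ℕ.≤ o i → ℕ→ℚ (c i ℕ.+ 2) ≤ α * ℕ→ℚ (o i)
    large-block i large = Eq.subst (_≤ α * ℕ→ℚ (o i)) (Eq.sym (ℕ→ℚ-+ (c i) 2))
      (≤-trans (+-monoˡ-≤ (ℕ→ℚ 2) (per-block i)) (bound+2≤α*o 5/3≤α (o i) large))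

    per-block-saving : ∀ i → ℕ→ℚ (c i ℕ.+ saving i) ≤ α * ℕ→ℚ (o i)
    per-block-saving i with i ≟ i₁ | i ≟ i₂
    ... | yes refl | _        = large-block i large₁
    ... | no _     | yes refl = large-block i large₂
    ... | no _     | no _     = Eq.subst (_≤ α * ℕ→ℚ (o i)) (cong ℕ→ℚ (Eq.sym (ℕP.+-identityʳ (c i))))
                                  (≤-trans (per-block i) (bound≤α*o 5/3≤α (o i)))

    saving₁ : saving i₁ ≡ 2
    saving₁ rewrite ⌊⌋-intro (i₁ ≟ i₁) refl = refl
    saving₂ : saving i₂ ≡ 2
    saving₂ rewrite ⌊⌋-intro (i₂ ≟ i₂) refl | ∨-zeroʳ ⌊ i₂ ≟ i₁ ⌋ = refl

    x+2≤Σ : x ℕ.+ 2 ℕ.≤ sumFin (λ i → c i ℕ.+ saving i)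
    x+2≤Σ = begin
      x ℕ.+ 2                                ≤⟨ ℕP.+-monoˡ-≤ 2 x≤2+Σc ⟩
      2 ℕ.+ sumFin c ℕ.+ 2                   ≡⟨ solve 1 (λ s → con 2 :+ s :+ con 2 := s :+ (con 2 :+ con 2)) refl (sumFin c) ⟩
      sumFin c ℕ.+ (2 ℕ.+ 2)                 ≡⟨ cong (sumFin c ℕ.+_) (cong₂ ℕ._+_ (Eq.sym saving₁) (Eq.sym saving₂)) ⟩
      sumFin c ℕ.+ (saving i₁ ℕ.+ saving i₂) ≤⟨ ℕP.+-monoʳ-≤ (sumFin c) (sumFin-pair saving i₁ i₂ i₁≢i₂) ⟩
      sumFin c ℕ.+ sumFin saving             ≡⟨ Eq.sym (sumFin-+ c saving) ⟩
      sumFin (λ i → c i ℕ.+ saving i)        ∎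
      where open ℕP.≤-Reasoning
            open import Data.Nat.Solver using () renaming (module +-*-Solver to ℕ-Solver)
            open ℕ-Solver

    x+2≤α*O : ℕ→ℚ x + ℕ→ℚ 2 ≤ α * ℕ→ℚ O
    x+2≤α*O = begin
      ℕ→ℚ x + ℕ→ℚ 2                          ≡⟨ Eq.sym (ℕ→ℚ-+ x 2) ⟩
      ℕ→ℚ (x ℕ.+ 2)                          ≤⟨ ℕ→ℚ-mono x+2≤Σ ⟩
      ℕ→ℚ (sumFin (λ i → c i ℕ.+ saving i))  ≤⟨ sum-scaled α α≥0 _ o per-block-saving ⟩
      α * ℕ→ℚ (sumFin o)                     ≤⟨ *-monoˡ-≤-nonNeg α {{α≥0}} (ℕ→ℚ-mono Σo≤O) ⟩
      α * ℕ→ℚ O                              ∎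
      where open ≤-Reasoning

module Walks where
  open import Data.Nat using (ℕ; zero; suc; _+_; _≤_; _<_)
  open import Data.Nat.Properties using (≤-refl; ≤-trans; n≤1+n; +-identityʳ; +-suc; m≤m+n)
  open import Data.Fin using (Fin)
  open import Data.Bool using (Bool; true)
  open import Data.Product using (proj₁; proj₂)
  open import Data.Sum using (inj₁; inj₂)
  open import Relation.Binary.PropositionalEquality
  open import Function using (_∘′_)

  module _ {H : Graph} where
    Joins-sym : ∀ {e u v} → Joins H e u v → Joins H e v u
    Joins-sym (inj₁ p) = inj₂ p
    Joins-sym (inj₂ p) = inj₁ p

    reach-trans : ∀ {u v w} → Reach H u v → Reach H v w → Reach H u w
    reach-trans here           q = q
    reach-trans (step e x j p) q = step e x j (reach-trans p q)

    reach-snoc : ∀ {u v w} e → Reach H u v → E H e ≡ true → Joins H e v w → Reach H u w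
    reach-snoc e p x j = reach-trans p (step e x j here)

    reach-sym : ∀ {u v} → Reach H u v → Reach H v u
    reach-sym here           = here
    reach-sym (step e x j p) = reach-snoc e (reach-sym p) x (Joins-sym j)

  reach-stays-in-V : (H : Graph) → WF H → ∀ {a b} → Reach H a b → V H a ≡ true → V H b ≡ true
  reach-stays-in-V H wf here va = va
  reach-stays-in-V H wf (step e x (inj₁ eq) p) _ =
    reach-stays-in-V H wf p (subst (λ z → V H z ≡ true) (cong proj₂ eq) (proj₂ (wf e x)))
  reach-stays-in-V H wf (step e x (inj₂ eq) p) _ =
    reach-stays-in-V H wf p (subst (λ z → V H z ≡ true) (cong proj₁ eq) (proj₁ (wf e x)))

  reach-mono : (H : Graph) (P Q : Fin (m H) → Bool) → (∀ f → P f ≡ true → Q f ≡ true) →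
    ∀ {u v} → Reach (withE H P) u v → Reach (withE H Q) u v
  reach-mono H P Q P⊆Q here           = here
  reach-mono H P Q P⊆Q (step e x j p) = step e (P⊆Q e x) j (reach-mono H P Q P⊆Q p)

  reach-change-V : (H : Graph) (W : Fin (n H) → Bool) → ∀ {u v} →
    Reach H u v → Reach (record H { V = W }) u v
  reach-change-V H W here           = here
  reach-change-V H W (step e x j p) = step e x j (reach-change-V H W p)

  walk-along : (H : Graph) (p : ℕ → Fin (n H)) (edge : ℕ → Fin (m H)) →
    (∀ t → Joins H (edge t) (p t) (p (suc t))) → ∀ a d →
    (∀ t → a ≤ t → t < a + d → E H (edge t) ≡ true) → Reach H (p a) (p (a + d))
  walk-along H p edge joins a zero    _    = subst (Reach H (p a) ∘′ p) (sym (+-identityʳ a)) here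
  walk-along H p edge joins a (suc d) used =
    step (edge a) (used a ≤-refl (subst (a <_) (sym (+-suc a d)) (m≤m+n (suc a) d))) (joins a)
      (subst (Reach H (p (suc a)) ∘′ p) (sym (+-suc a d))
        (walk-along H p edge joins (suc a) d λ t a<t t<end → used t (≤-trans (n≤1+n a) a<t)
                                                           (subst (t <_) (sym (+-suc a d)) t<end)))

-- A spanning cycle is given (in Defs) by nodes
-- cv i and edges ce i joining cv i to cv (next i); indexing it by ℕ
-- modulo its length turns it into the periodic walk of walk-along.
module Cycles where
  open import Data.Nat using (ℕ; zero; suc; _+_; _∸_; _≤_; _<_; _<?_)
  open import Data.Nat.Properties using (<-≤-trans; <⇒≱; m+[n∸m]≡n; <⇒≤)
  open import Data.Nat.DivMod using (_mod_; _%_; m<n⇒m%n≡m; n%n≡0; m%n%n≡m%n; %-distribˡ-+)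
  open import Data.Fin using (Fin; zero; suc; toℕ; _≟_)
  open import Data.Fin.Properties using (toℕ-injective; toℕ-fromℕ<; toℕ<n; any?)
  open import Data.Bool using (Bool; true)
  open import Data.Product using (_,_)
  open import Relation.Nullary using (yes; no)
  open import Relation.Nullary.Decidable using (_×-dec_)
  open import Relation.Binary.PropositionalEquality
  open import Function using (_∘_)
  open Walks

  pos : ∀ {k} → ℕ → Fin (suc k)
  pos {k} t = t mod suc k

  toℕ-pos : ∀ {k} t → toℕ (pos {k} t) ≡ t % suc k
  toℕ-pos {k} t = toℕ-fromℕ< _

  next-pos : ∀ {k} t → next (pos {k} t) ≡ pos (suc t)
  next-pos {k} t = toℕ-injective (begin
    toℕ (next (pos t))                 ≡⟨ toℕ-fromℕ< _ ⟩
    suc (toℕ (pos t)) % suc k          ≡⟨ cong (λ z → suc z % suc k) (toℕ-pos t) ⟩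
    (1 + t % suc k) % suc k            ≡⟨ %-distribˡ-+ 1 (t % suc k) (suc k) ⟩
    (1 % suc k + t % suc k % suc k) % suc k ≡⟨ cong (λ z → (1 % suc k + z) % suc k) (m%n%n≡m%n t (suc k)) ⟩
    (1 % suc k + t % suc k) % suc k    ≡⟨ sym (%-distribˡ-+ 1 t (suc k)) ⟩
    suc t % suc k                      ≡⟨ sym (toℕ-pos (suc t)) ⟩
    toℕ (pos (suc t))                  ∎)
    where open ≡-Reasoning

  pos-< : ∀ {k} t → t < suc k → toℕ (pos {k} t) ≡ t
  pos-< t t<l = trans (toℕ-pos t) (m<n⇒m%n≡m t<l)

  pos-toℕ : ∀ {k} (i : Fin (suc k)) → pos (toℕ i) ≡ i
  pos-toℕ i = toℕ-injective (pos-< (toℕ i) (toℕ<n i))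

  pos-length : ∀ {k} → pos {k} (suc k) ≡ zero
  pos-length {k} = toℕ-injective (trans (toℕ-pos (suc k)) (n%n≡0 (suc k)))

  joins-pos : (H : Graph) {k : ℕ} (cv : Fin (suc k) → Fin (n H)) (ce : Fin (suc k) → Fin (m H)) →
    (∀ i → Joins H (ce i) (cv i) (cv (next i))) →
    ∀ t → Joins H (ce (pos t)) (cv (pos t)) (cv (pos (suc t)))
  joins-pos H cv ce joins t = subst (Joins H (ce (pos t)) (cv (pos t)) ∘ cv) (next-pos t) (joins (pos t))

  -- After deleting at most one edge e from a cycle, every node of the
  -- cycle is still joined to the first node cv zero: walk forwards if
  -- e comes after it, backwards otherwise.
  cycle-minus-edge : (H : Graph) (k : ℕ) (cv : Fin (suc k) → Fin (n H)) (ce : Fin (suc k) → Fin (m H)) →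
    (∀ i j → ce i ≡ ce j → i ≡ j) → (∀ i → Joins H (ce i) (cv i) (cv (next i))) →
    (Y : Fin (m H) → Bool) (e : Fin (m H)) → (∀ i → ce i ≢ e → Y (ce i) ≡ true) →
    ∀ j → Reach (withE H Y) (cv j) (cv zero)
  cycle-minus-edge H k cv ce ce-inj joins Y e kept j
    with any? (λ i → (toℕ i <? toℕ j) ×-dec (ce i ≟ e))
  ... | yes (i₀ , i₀<j , ce-i₀≡e) =
    subst₂ (Reach (withE H Y)) (cong cv (pos-toℕ j)) (cong cv end≡zero)
      (walk-along (withE H Y) (cv ∘ pos) (ce ∘ pos) (joins-pos H cv ce joins) (toℕ j) (suc k ∸ toℕ j) after-j)
    where
    end≡zero : pos (toℕ j + (suc k ∸ toℕ j)) ≡ zero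
    end≡zero = trans (cong pos (m+[n∸m]≡n (<⇒≤ (toℕ<n j)))) pos-length
    after-j : ∀ t → toℕ j ≤ t → t < toℕ j + (suc k ∸ toℕ j) → Y (ce (pos t)) ≡ true
    after-j t j≤t t<end = kept (pos t) λ ce≡e →
      <⇒≱ i₀<j (subst (λ z → toℕ j ≤ toℕ z) (ce-inj (pos t) i₀ (trans ce≡e (sym ce-i₀≡e)))
                 (subst (toℕ j ≤_) (sym (pos-< t (subst (t <_) (m+[n∸m]≡n (<⇒≤ (toℕ<n j))) t<end))) j≤t))
  ... | no ¬e-before-j =
    reach-sym (subst (Reach (withE H Y) (cv zero)) (cong cv (pos-toℕ j))
      (walk-along (withE H Y) (cv ∘ pos) (ce ∘ pos) (joins-pos H cv ce joins) 0 (toℕ j) before-j))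
    where
    before-j : ∀ t → 0 ≤ t → t < toℕ j → Y (ce (pos t)) ≡ true
    before-j t _ t<j = kept (pos t) λ ce≡e →
      ¬e-before-j (pos t , subst (_< toℕ j) (sym (pos-< t (<-≤-trans t<j (<⇒≤ (toℕ<n j))))) t<j , ce≡e)

-- Double negation commutes with finite products; this is how classical
-- choices (decidability of reachability, existence of an optimum) are
-- made for finitely many objects at once when the goal is decidable.
module Classical where
  open import Data.Nat using (zero; suc)
  open import Data.Fin using (Fin; zero; suc)
  open import Relation.Nullary using (¬_; Dec)
  open import Relation.Nullary.Decidable.Core using (¬¬-excluded-middle)
  open import Function using (_∘_)

  ¬¬-Π : ∀ {k} (A : Fin k → Set) → (∀ i → ¬ ¬ A i) → ¬ ¬ (∀ i → A i)
  ¬¬-Π {zero}  A _  no-all = no-all λ ()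
  ¬¬-Π {suc k} A ¬¬A no-all =
    ¬¬A zero λ a₀ → ¬¬-Π (A ∘ suc) (¬¬A ∘ suc) λ as → no-all λ { zero → a₀ ; (suc i) → as i }

  ¬¬-decide : ∀ {k} (P : Fin k → Set) → ¬ ¬ (∀ i → Dec (P i))
  ¬¬-decide P = ¬¬-Π (λ i → Dec (P i)) (λ _ → ¬¬-excluded-middle)

module Contraction (G : Graph) (S : Fin (n G) → Bool) where
  open import Data.Nat using (zero; suc; _≤_)
  open import Data.Fin using (Fin; zero; suc; _≟_)
  open import Data.Fin.Properties using (any?)
  open import Data.Bool using (Bool; true; false; _∧_; _∨_; not; if_then_else_)
  open import Data.Bool.Properties using () renaming (_≟_ to _≟ᵇ_)
  open import Data.Product using (Σ; _×_; _,_; proj₁; proj₂)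
  open import Data.Sum using (_⊎_; inj₁; inj₂)
  open import Relation.Nullary using (Dec; yes; no; contradiction)
  open import Relation.Nullary.Decidable using (⌊_⌋)
  open import Relation.Binary.PropositionalEquality
  open Booleans
  open Walks

  G/S : Graph
  G/S = contract G S

  Rest : Graph
  Rest = deleteNode G/S zero

  ι : Fin (n G) → Fin (suc (n G))
  ι v = if S v then zero else suc v

  ι-inside : ∀ {v} → S v ≡ true → ι v ≡ zero
  ι-inside h rewrite h = refl

  ι-outside : ∀ {v} → S v ≡ false → ι v ≡ suc v
  ι-outside h rewrite h = refl

  ι-cases : ∀ a → (S a ≡ true × ι a ≡ zero) ⊎ (S a ≡ false × ι a ≡ suc a)
  ι-cases a with S a
  ... | true  = inj₁ (refl , refl)
  ... | false = inj₂ (refl , refl)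

  ι≡suc : ∀ {a y} → ι a ≡ suc y → a ≡ y
  ι≡suc {a} eq with S a
  ι≡suc () | true
  ι≡suc refl | false = refl

  Joins-ι : ∀ {f y y′} → Joins G f y y′ → Joins G/S f (ι y) (ι y′)
  Joins-ι (inj₁ eq) = inj₁ (cong (λ p → ι (proj₁ p) , ι (proj₂ p)) eq)
  Joins-ι (inj₂ eq) = inj₂ (cong (λ p → ι (proj₁ p) , ι (proj₂ p)) eq)

  ends-satisfy : (P : Fin (n G) → Set) → ∀ {f y y′} → Joins G f y y′ → P y → P y′ →
    P (end₁ G f) × P (end₂ G f)
  ends-satisfy P (inj₁ eq) py py′ = subst P (sym (cong proj₁ eq)) py , subst P (sym (cong proj₂ eq)) py′
  ends-satisfy P (inj₂ eq) py py′ = subst P (sym (cong proj₁ eq)) py′ , subst P (sym (cong proj₂ eq)) py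

  E-G/S : ∀ {f y y′} → Joins G f y y′ → E G f ≡ true → S y ≡ false → E G/S f ≡ true
  E-G/S {f} j ef sy = ∧-intro ef (not-both (an-end-outside j))
    where
    an-end-outside : ∀ {y′} → Joins G f _ y′ → S (end₁ G f) ≡ false ⊎ S (end₂ G f) ≡ false
    an-end-outside (inj₁ eq) = inj₁ (subst (λ z → S z ≡ false) (sym (cong proj₁ eq)) sy)
    an-end-outside (inj₂ eq) = inj₂ (subst (λ z → S z ≡ false) (sym (cong proj₂ eq)) sy)

  V-Rest : ∀ y → V Rest (suc y) ≡ true → V G y ≡ true × S y ≡ false
  V-Rest y h with V G y | S y
  ... | true  | false = refl , refl
  ... | true  | true  = contradiction h false≢true
  ... | false | _     = contradiction h false≢true

  edge-at : ∀ {f y v} → Joins G/S f (suc y) v → Σ (Fin (n G)) λ b → Joins G f y b × ι b ≡ v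
  edge-at {f} (inj₁ eq) = end₂ G f , inj₁ (cong (_, end₂ G f) (ι≡suc (cong proj₁ eq))) , cong proj₂ eq
  edge-at {f} (inj₂ eq) = end₁ G f , inj₂ (cong (end₁ G f ,_) (ι≡suc (cong proj₂ eq))) , cong proj₁ eq

  -- A walk in G/S from a node y of G to v̂ comes from a walk in G from
  -- y to a node of S (it lifts up to its first visit of v̂).
  lift-walk : (P Y : Fin (m G) → Bool) → (∀ f → P f ≡ true → Y f ≡ true) →
    ∀ {u w} → Reach (withE G/S P) u w → w ≡ zero → ∀ y → u ≡ suc y →
    Σ (Fin (n G)) λ s → S s ≡ true × Reach (withE G Y) y s
  lift-walk P Y P⊆Y here () y refl
  lift-walk P Y P⊆Y (step f x j p) w≡v̂ y refl with edge-at j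
  ... | b , jG , ιb≡v with ι-cases b
  ...   | inj₁ (sb , _) = b , sb , step f (P⊆Y f x) jG here
  ...   | inj₂ (_ , ιb≡sucb) with lift-walk P Y P⊆Y p w≡v̂ b (trans (sym ιb≡v) ιb≡sucb)
  ...     | s , ss , r = s , ss , step f (P⊆Y f x) jG r

  component-closed : ∀ {A} → IsComponent Rest A → ∀ {f u v} → E Rest f ≡ true →
    Joins Rest f u v → A u ≡ true → A v ≡ true
  component-closed {A} (_ , _ , _ , closed) {f} ef (inj₁ eq) au =
    subst (λ z → A z ≡ true) (cong proj₂ eq)
      (proj₁ (closed f ef) (subst (λ z → A z ≡ true) (sym (cong proj₁ eq)) au))
  component-closed {A} (_ , _ , _ , closed) {f} ef (inj₂ eq) au =
    subst (λ z → A z ≡ true) (cong proj₁ eq)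
      (proj₂ (closed f ef) (subst (λ z → A z ≡ true) (sym (cong proj₂ eq)) au))

  component-reach-closed : ∀ {A A′} → IsComponent Rest A′ → ∀ {v w} →
    Reach (induced Rest A) v w → A′ v ≡ true → A′ w ≡ true
  component-reach-closed A′-comp here           a′v = a′v
  component-reach-closed A′-comp (step e x j p) a′v =
    component-reach-closed A′-comp p (component-closed A′-comp (proj₁ (∧-elim x)) j a′v)

  component-⊆ : ∀ {A A′} → IsComponent Rest A → IsComponent Rest A′ → ∀ {v w} →
    A v ≡ true → A′ v ≡ true → A w ≡ true → A′ w ≡ true
  component-⊆ (A⊆V , _ , A-conn , _) A′-comp {v} {w} av a′v aw =
    component-reach-closed A′-comp (A-conn v w (∧-intro (A⊆V v av) av) (∧-intro (A⊆V w aw) aw)) a′v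

  components-meet⇒same : ∀ {A A′} → IsComponent Rest A → IsComponent Rest A′ →
    ∀ v → A v ≡ true → A′ v ≡ true → SameSet A A′
  components-meet⇒same {A} {A′} A-comp A′-comp v av a′v w with A w in aw | A′ w in a′w
  ... | true  | true  = refl
  ... | false | false = refl
  ... | true  | false = contradiction (trans (sym a′w) (component-⊆ A-comp A′-comp av a′v aw)) false≢true
  ... | false | true  = contradiction (trans (sym aw) (component-⊆ A′-comp A-comp a′v av a′w)) false≢true

  E-Rest-intro : ∀ {f y y′} → Joins G f y y′ → E G f ≡ true → S y ≡ false → S y′ ≡ false →
    E Rest f ≡ true
  E-Rest-intro j ef sy sy′ = ∧-intro (E-G/S j ef sy)
    (let (o₁ , o₂) = ends-satisfy (λ v → not ⌊ ι v ≟ zero ⌋ ≡ true) j (off sy) (off sy′) in ∧-intro o₁ o₂)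
    where
    off : ∀ {v} → S v ≡ false → not ⌊ ι v ≟ zero ⌋ ≡ true
    off sv rewrite sv = refl

  V-Rest-intro : ∀ {x} → V G x ≡ true → S x ≡ false → V Rest (suc x) ≡ true
  V-Rest-intro vx sx rewrite vx | sx = refl

  module _ (wfG : WF G) where

    WF-Rest : WF Rest
    WF-Rest e x with ∧-elim x
    ... | e∈G/S , off-v̂ with ∧-elim off-v̂ | ∧-elim e∈G/S
    ...   | n₁ , n₂ | e∈G , _ =
      end-in-Rest (end₁ G e) (proj₁ (wfG e e∈G)) n₁ , end-in-Rest (end₂ G e) (proj₂ (wfG e e∈G)) n₂
      where
      end-in-Rest : ∀ a → V G a ≡ true → not ⌊ ι a ≟ zero ⌋ ≡ true → V Rest (ι a) ≡ true
      end-in-Rest a va off with S a in sa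
      ... | true  = contradiction off false≢true
      ... | false = V-Rest-intro va sa

    reachable-component : ∀ x → V G x ≡ true → S x ≡ false →
      (decide : ∀ v → Dec (Reach Rest (suc x) v)) → IsComponent Rest (λ v → ⌊ decide v ⌋)
    reachable-component x vx sx decide =
        (λ v h → reach-stays-in-V Rest WF-Rest (out h) (V-Rest-intro vx sx))
      , (suc x , into here)
      , (λ u v hu hv → reach-trans (reach-sym (inside here (out (proj₂ (∧-elim {V Rest u} hu)))))
                                   (inside here (out (proj₂ (∧-elim {V Rest v} hv)))))
      , (λ e e∈Rest → (λ h → into (reach-snoc e (out h) e∈Rest (inj₁ refl)))
                    , (λ h → into (reach-snoc e (out h) e∈Rest (inj₂ refl))))
      where
      C : Fin (suc (n G)) → Bool
      C v = ⌊ decide v ⌋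

      into : ∀ {v} → Reach Rest (suc x) v → C v ≡ true
      into {v} = ⌊⌋-intro (decide v)

      out : ∀ {v} → C v ≡ true → Reach Rest (suc x) v
      out {v} = ⌊⌋-elim (decide v)

      inside : ∀ {a b} → Reach Rest (suc x) a → Reach Rest a b → Reach (induced Rest C) a b
      inside ra here = here
      inside ra (step {v = c} f ef j p) =
        step f (∧-intro ef (ends-in-C j)) j (inside (reach-snoc f ra ef j) p)
        where
        ends-in-C : Joins Rest f _ c → C (end₁ Rest f) ∧ C (end₂ Rest f) ≡ true
        ends-in-C (inj₁ eq) = ∧-intro (into (subst (Reach Rest (suc x)) (sym (cong proj₁ eq)) ra))
                                      (into (subst (Reach Rest (suc x)) (sym (cong proj₂ eq)) (reach-snoc f ra ef j)))
        ends-in-C (inj₂ eq) = ∧-intro (into (subst (Reach Rest (suc x)) (sym (cong proj₁ eq)) (reach-snoc f ra ef j)))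
                                      (into (subst (Reach Rest (suc x)) (sym (cong proj₂ eq)) ra))

    in-some-component : ∀ {k} (D : Fin k → Fin (suc (n G)) → Bool) → BlockEnum G/S zero D →
      ∀ x → V G x ≡ true → S x ≡ false → Σ (Fin k) λ i → D i (suc x) ≡ true
    in-some-component D (_ , _ , covers) x vx sx with any? (λ i → D i (suc x) ≟ᵇ true)
    ... | yes found = found
    ... | no none   = ⊥-elim (Classical.¬¬-decide (Reach Rest (suc x)) λ decide →
      let (i , same) = covers _ (reachable-component x vx sx decide)
      in none (i , trans (sym (same (suc x))) (⌊⌋-intro (decide (suc x)) here)))
      where open import Data.Empty using (⊥-elim)

  module Block (A : Fin (suc (n G)) → Bool) (A-comp : IsComponent Rest A) where

    B : Graph
    B = block G/S zero A

    V-B-suc : ∀ y → V B (suc y) ≡ true → V G y ≡ true × S y ≡ false × A (suc y) ≡ true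
    V-B-suc y h with V G y | S y
    ... | true  | false = refl , refl , h
    ... | true  | true  = contradiction h false≢true
    ... | false | _     = contradiction h false≢true

    V-B-intro : ∀ {y} → V G y ≡ true → S y ≡ false → A (suc y) ≡ true → V B (suc y) ≡ true
    V-B-intro vy sy ay rewrite vy | sy = ay

    in-B : Fin (suc (n G)) → Bool
    in-B v = ⌊ v ≟ zero ⌋ ∨ A v

    in-B-inside : ∀ {v} → S v ≡ true → in-B (ι v) ≡ true
    in-B-inside sv rewrite sv = refl

    in-B-outside : ∀ {v} → S v ≡ false → A (suc v) ≡ true → in-B (ι v) ≡ true
    in-B-outside sv av rewrite sv = av

    E-B-intro : ∀ {f y y′} → Joins G f y y′ → E G f ≡ true → S y ≡ false →
      in-B (ι y) ≡ true → in-B (ι y′) ≡ true → E B f ≡ true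
    E-B-intro jG ef sy iy iy′ = ∧-intro (E-G/S jG ef sy)
      (let (i₁ , i₂) = ends-satisfy (λ v → in-B (ι v) ≡ true) jG iy iy′ in ∧-intro i₁ i₂)

    -- A walk of G from a node y of the component A into S gives a walk of
    -- B from y to v̂ (up to its first visit of S, it stays in A).
    walk-into-block : (Yg Z : Fin (m G) → Bool) → (∀ f → Yg f ≡ true → E B f ≡ true → Z f ≡ true) →
      (∀ f → Yg f ≡ true → E G f ≡ true) →
      ∀ {y w} → Reach (withE G Yg) y w → S w ≡ true → S y ≡ false → A (suc y) ≡ true →
      Reach (withE B Z) (suc y) zero
    walk-into-block Yg Z to-Z Yg⊆E here sw sy _ = contradiction (trans (sym sy) sw) false≢true
    walk-into-block Yg Z to-Z Yg⊆E {y} (step {v = y′} f x j p) sw sy ay with S y′ in sy′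
    ... | true  = step f (to-Z f x (E-B-intro j (Yg⊆E f x) sy (in-B-outside sy ay) (in-B-inside sy′))) jB here
      where
      jB : Joins B f (suc y) zero
      jB = subst₂ (Joins G/S f) (ι-outside sy) (ι-inside sy′) (Joins-ι j)
    ... | false = step f (to-Z f x (E-B-intro j (Yg⊆E f x) sy (in-B-outside sy ay) (in-B-outside sy′ ay′))) jB
                    (walk-into-block Yg Z to-Z Yg⊆E p sw sy′ ay′)
      where
      jB : Joins B f (suc y) (suc y′)
      jB = subst₂ (Joins G/S f) (ι-outside sy) (ι-outside sy′) (Joins-ι j)
      ay′ : A (suc y′) ≡ true
      ay′ = component-closed A-comp (E-Rest-intro j (Yg⊆E f x) sy sy′) jB ay

    block-connected : ∀ c → S c ≡ true → V G c ≡ true → (Yg Z : Fin (m G) → Bool) →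
      (∀ f → Yg f ≡ true → E B f ≡ true → Z f ≡ true) → (∀ f → Yg f ≡ true → E G f ≡ true) →
      Connected (withE G Yg) → Connected (withE B Z)
    block-connected c sc vc Yg Z to-Z Yg⊆E Yg-conn u v hu hv =
      reach-trans (to-v̂ u hu) (reach-sym (to-v̂ v hv))
      where
      to-v̂ : ∀ v → V B v ≡ true → Reach (withE B Z) v zero
      to-v̂ zero    _ = here
      to-v̂ (suc y) h with V-B-suc y h
      ... | vy , sy , ay = walk-into-block Yg Z to-Z Yg⊆E (Yg-conn y c vy vc) sc sy ay

    restrict-ECSS : ∀ c → S c ≡ true → V G c ≡ true → (H : Fin (m G) → Bool) → IsECSS G H →
      IsECSS B (λ f → H f ∧ E B f)
    restrict-ECSS c sc vc H (H⊆E , _ , H-conn , H-del) =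
        (λ f h → proj₂ (∧-elim {H f} h))
      , two-nodes
      , block-connected c sc vc H R (λ f h e → ∧-intro h e) H⊆E H-conn
      , (λ g g∈R → block-connected c sc vc (λ f → H f ∧ not ⌊ f ≟ g ⌋) (λ f → R f ∧ not ⌊ f ≟ g ⌋)
            (λ f h e → let (hf , f≢g) = ∧-elim {H f} h in ∧-intro (∧-intro hf e) f≢g)
            (λ f h → H⊆E f (proj₁ (∧-elim {H f} h)))
            (H-del g (proj₁ (∧-elim {H g} g∈R))))
      where
      R : Fin (m G) → Bool
      R f = H f ∧ E B f
      two-nodes : 2 ≤ nodeCount (withE B R)
      two-nodes with proj₁ (proj₂ A-comp)
      ... | zero  , av = contradiction (proj₁ A-comp zero av) false≢true
      ... | suc y , av with V-Rest y (proj₁ A-comp (suc y) av)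
      ...   | vy , sy = FiniteSums.count-two (V B) zero (suc y) (λ ()) refl (V-B-intro vy sy av)

  in-block⇒in-comp : (X : Fin (suc (n G)) → Bool) → ∀ {v} → S v ≡ false →
    ⌊ ι v ≟ zero ⌋ ∨ X (ι v) ≡ true → X (suc v) ≡ true
  in-block⇒in-comp X sv h rewrite sv = h

  blocks-edge-disjoint : ∀ {A A′} → IsComponent Rest A → IsComponent Rest A′ → ∀ f →
    E (block G/S zero A) f ≡ true → E (block G/S zero A′) f ≡ true → SameSet A A′
  blocks-edge-disjoint {A} {A′} A-comp A′-comp f f∈B f∈B′
    with ∧-elim {E G/S f} f∈B | ∧-elim {E G/S f} f∈B′
  ... | f∈G/S , ends∈B | _ , ends∈B′ with not-both⁻ (proj₂ (∧-elim {E G f} f∈G/S))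
  ...   | inj₁ s₁ = components-meet⇒same A-comp A′-comp (suc (end₁ G f))
                      (in-block⇒in-comp A s₁ (proj₁ (∧-elim ends∈B))) (in-block⇒in-comp A′ s₁ (proj₁ (∧-elim ends∈B′)))
  ...   | inj₂ s₂ = components-meet⇒same A-comp A′-comp (suc (end₂ G f))
                      (in-block⇒in-comp A s₂ (proj₂ (∧-elim ends∈B))) (in-block⇒in-comp A′ s₂ (proj₂ (∧-elim ends∈B′)))

  block-ECSS-cong : ∀ {A A′} → SameSet A A′ → ∀ F →
    IsECSS (block G/S zero A) F → IsECSS (block G/S zero A′) F
  block-ECSS-cong {A} {A′} same F (F⊆E , two , conn , del) =
      (λ e h → trans (sym (E-eq e)) (F⊆E e h))
    , ≤-trans two (FiniteSums.sumFin-mono _ _ λ v → ≤-reflexive (cong (λ z → if z then 1 else 0) (V-eq v)))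
    , transport F conn
    , (λ g h → transport (λ f → F f ∧ not ⌊ f ≟ g ⌋) (del g h))
    where
    open import Data.Nat.Properties using (≤-trans; ≤-reflexive)
    E-eq : ∀ e → E (block G/S zero A) e ≡ E (block G/S zero A′) e
    E-eq e rewrite same (end₁ G/S e) | same (end₂ G/S e) = refl
    V-eq : ∀ v → V (block G/S zero A) v ≡ V (block G/S zero A′) v
    V-eq v rewrite same v = refl
    transport : ∀ P → Connected (withE (block G/S zero A) P) → Connected (withE (block G/S zero A′) P)
    transport P c u v hu hv =
      reach-change-V (withE (block G/S zero A) P) (V (block G/S zero A′))
        (c u v (trans (V-eq u) hu) (trans (V-eq v) hv))

  block-IsOpt-cong : ∀ {A A′} → SameSet A A′ → ∀ o →
    IsOpt (block G/S zero A) o → IsOpt (block G/S zero A′) o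
  block-IsOpt-cong same o ((F , ecss , cost≡o) , minimal) =
      (F , block-ECSS-cong same F ecss , cost≡o)
    , λ F′ ecss′ → minimal F′ (block-ECSS-cong (λ v → sym (same v)) F′ ecss′)

-- Optimal 2-ECSSs exist classically: minimise the cost by strong induction.
module Optima where
  open import Data.Nat using (ℕ; _≤_; _<_)
  open import Data.Nat.Properties using (≤-refl; ≤-trans; <⇒≤; ≮⇒≥)
  open import Data.Nat.Induction using (<-rec)
  open import Data.Product using (Σ; _×_; _,_)
  open import Relation.Nullary using (¬_; yes; no)
  open import Relation.Nullary.Decidable.Core using (¬¬-excluded-middle)
  open import Relation.Binary.PropositionalEquality using (_≡_; refl)

  optimum-below : (H : Graph) → ∀ c → (Σ (Fin (m H) → Bool) λ F → IsECSS H F × costOf H F ≡ c) →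
    ¬ ¬ (Σ ℕ λ o → IsOpt H o × o ≤ c)
  optimum-below H = <-rec _ λ c smaller (F , ecss , cost≡c) no-optimum →
    ¬¬-excluded-middle {A = Σ (Fin (m H) → Bool) λ F′ → IsECSS H F′ × costOf H F′ < c} λ where
      (yes (F′ , ecss′ , cheaper)) → smaller cheaper (F′ , ecss′ , refl)
        λ (o , opt , o≤) → no-optimum (o , opt , ≤-trans o≤ (<⇒≤ cheaper))
      (no none) → no-optimum
        (c , ((F , ecss , cost≡c) , λ F′ ecss′ → ≮⇒≥ λ cheaper → none (F′ , ecss′ , cheaper)) , ≤-refl)

module Decomposition (G : Graph) (wfG : WF G) (S : Fin (n G) → Bool) where
  open import Data.Nat using (ℕ; zero; suc; _≤_)
  open import Data.Fin using (zero; suc; _≟_)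
  open import Data.Bool using (true; false; _∧_; _∨_; not)
  open import Data.Product using (Σ; _×_; _,_; proj₁; proj₂)
  open import Data.Sum using (inj₁; inj₂)
  open import Relation.Nullary using (¬_; contradiction)
  open import Relation.Nullary.Negation using (¬¬-map)
  open import Relation.Nullary.Decidable using (⌊_⌋)
  open import Relation.Binary.PropositionalEquality
  open Booleans
  open Walks
  open Cycles using (cycle-minus-edge)
  open Contraction G S

  -- If Y joins all of S to a root r and contains a connected spanning
  -- subgraph of every block, then Y connects G: a node outside S lies in
  -- some block, and the walk to v̂ in that block lifts to a walk into S.
  union-connected : ∀ {k} (D : Fin k → Fin (suc (n G)) → Bool) → BlockEnum G/S zero D →
    (Y : Fin (m G) → Bool) (r : Fin (n G)) → (∀ s → S s ≡ true → Reach (withE G Y) s r) →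
    (∀ i → Σ (Fin (m G) → Bool) λ P →
             Connected (withE (block G/S zero (D i)) P) × (∀ f → P f ≡ true → Y f ≡ true)) →
    Connected (withE G Y)
  union-connected D enum Y r S-to-r blocks u v vu vv =
    reach-trans (to-r u vu) (reach-sym (to-r v vv))
    where
    to-r : ∀ x → V G x ≡ true → Reach (withE G Y) x r
    to-r x vx with S x in sx
    ... | true  = S-to-r x sx
    ... | false with in-some-component wfG D enum x vx sx
    ...   | i , x∈Di with blocks i
    ...     | P , P-conn , P⊆Y with lift-walk P Y P⊆Y
                (reach-change-V (withE (block G/S zero (D i)) P) (V G/S)
                   (P-conn (suc x) zero (Block.V-B-intro (D i) (proj₁ enum i) vx sx x∈Di) refl))
                refl x refl
    ...       | s , ss , x-to-s = reach-trans x-to-s (S-to-r s ss)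

  union-ECSS : 2 ≤ nodeCount G → (∀ v → S v ≡ true → V G v ≡ true) →
    ∀ {k} (D : Fin k → Fin (suc (n G)) → Bool) → BlockEnum G/S zero D →
    (F : Fin k → Fin (m G) → Bool) → (∀ i → IsECSS (block G/S zero (D i)) (F i)) →
    (Ĉ : Fin (m G) → Bool) → SpanningCycle (induced G S) Ĉ →
    IsECSS G (λ e → Ĉ e ∨ anyFin (λ i → F i e))
  union-ECSS two S⊆V D enum F F-ECSS Ĉ (l , cv , ce , _ , _ , _ , covers , ce-inj , ce∈C , joins , Ĉ⊆ce , ce⊆Ĉ) =
    U⊆E , two , U-connected , λ e _ → connected-without e
    where
    U : Fin (m G) → Bool
    U e = Ĉ e ∨ anyFin (λ i → F i e)

    F⊆U : ∀ i f → F i f ≡ true → U f ≡ true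
    F⊆U i f h = ∨-introʳ (Ĉ f) (anyFin-intro (λ j → F j f) i h)

    U⊆E : ∀ e → U e ≡ true → E G e ≡ true
    U⊆E e h with ∨-elim {Ĉ e} h
    ... | inj₁ ĉe with Ĉ⊆ce e ĉe
    ...   | i , refl = proj₁ (∧-elim (ce∈C i))
    U⊆E e h | inj₂ fe with anyFin-elim (λ i → F i e) fe
    ...   | i , fie = proj₁ (∧-elim (proj₁ (∧-elim (proj₁ (F-ECSS i) e fie))))

    -- U stays connected after deleting any single edge e, in U or not:
    -- the cycle loses at most e, and each block keeps a connected
    -- spanning subgraph (F i, or F i − e when e ∈ F i)
    connected-without : ∀ e → Connected (deleteEdge (withE G U) e)
    connected-without e = union-connected D enum Y (cv zero) S-to-root blocks
      where
      Y : Fin (m G) → Bool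
      Y f = U f ∧ not ⌊ f ≟ e ⌋

      S-to-root : ∀ s → S s ≡ true → Reach (withE G Y) s (cv zero)
      S-to-root s ss with covers s (∧-intro (S⊆V s ss) ss)
      ... | j , refl = cycle-minus-edge G l cv ce ce-inj joins Y e
                         (λ i ce≢e → ∧-intro (∨-introˡ _ (ce⊆Ĉ i)) (≟-distinct ce≢e)) j

      blocks : ∀ i → Σ (Fin (m G) → Bool) λ P →
        Connected (withE (block G/S zero (D i)) P) × (∀ f → P f ≡ true → Y f ≡ true)
      blocks i with F i e in fie
      ... | true  = (λ f → F i f ∧ not ⌊ f ≟ e ⌋) , proj₂ (proj₂ (proj₂ (F-ECSS i))) e fie ,
                    λ f h → let (h₁ , h₂) = ∧-elim {F i f} h in ∧-intro (F⊆U i f h₁) h₂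
      ... | false = F i , proj₁ (proj₂ (proj₂ (F-ECSS i))) ,
                    λ f h → ∧-intro (F⊆U i f h) (≟-distinct λ { refl → contradiction (trans (sym fie) h) false≢true })

    U-connected : Connected (withE G U)
    U-connected u v hu hv =
      reach-mono G _ U (λ f h → proj₁ (∧-elim {U f} h)) (connected-without (ce zero) u v hu hv)

  -- Restricting an optimal 2-ECSS of G to the edge-disjoint blocks
  -- (a node c ∈ S keeps each restriction connected) shows that the
  -- optima of the blocks add up to at most opt(G).  These optima exist
  -- only classically, hence the double negation.
  blocks-opt-sum : ∀ c → S c ≡ true → V G c ≡ true →
    ∀ {k} (D : Fin k → Fin (suc (n G)) → Bool) → BlockEnum G/S zero D →
    ∀ O → IsOpt G O →
    ¬ ¬ (Σ (Fin k → ℕ) λ o → (∀ i → IsOpt (block G/S zero (D i)) (o i)) × sumFin o ≤ O)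
  blocks-opt-sum c sc vc {k} D (components , distinct , _) O ((H , H-ECSS , cost≡O) , _) =
    ¬¬-map assemble (Classical.¬¬-Π _ λ i →
      Optima.optimum-below (B i) (costOf G (R i)) (R i , restricted i , refl))
    where
    open import Data.Nat.Properties using (≤-trans)
    open FiniteSums using (sumFin-mono; costOf-disjoint)

    B : Fin k → Graph
    B i = block G/S zero (D i)

    R : Fin k → Fin (m G) → Bool
    R i f = H f ∧ E (B i) f

    restricted : ∀ i → IsECSS (B i) (R i)
    restricted i = Block.restrict-ECSS (D i) (components i) c sc vc H H-ECSS

    ΣR≤O : sumFin (λ i → costOf G (R i)) ≤ O
    ΣR≤O = subst (sumFin (λ i → costOf G (R i)) ≤_) cost≡O (costOf-disjoint G R H
      (λ e i j rie rje → distinct i j (blocks-edge-disjoint (components i) (components j) e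
                                         (proj₂ (∧-elim {H e} rie)) (proj₂ (∧-elim {H e} rje))))
      (λ i e h → proj₁ (∧-elim {H e} h)))

    assemble : (∀ i → Σ ℕ λ o → IsOpt (B i) o × o ≤ costOf G (R i)) →
      Σ (Fin k → ℕ) λ o → (∀ i → IsOpt (B i) (o i)) × sumFin o ≤ O
    assemble opt = (λ i → proj₁ (opt i)) , (λ i → proj₁ (proj₂ (opt i))) ,
                   ≤-trans (sumFin-mono _ _ λ i → proj₂ (proj₂ (opt i))) ΣR≤O

  two-large-blocks : ∀ {k} (D : Fin k → Fin (suc (n G)) → Bool) → BlockEnum G/S zero D →
    ∀ D₁ D₂ → IsComponent Rest D₁ → IsComponent Rest D₂ → ¬ SameSet D₁ D₂ →
    OptAtLeast3 (block G/S zero D₁) → OptAtLeast3 (block G/S zero D₂) →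
    Σ (Fin k) λ i₁ → Σ (Fin k) λ i₂ → i₁ ≢ i₂ ×
      OptAtLeast3 (block G/S zero (D i₁)) × OptAtLeast3 (block G/S zero (D i₂))
  two-large-blocks D (_ , _ , covers) D₁ D₂ D₁-comp D₂-comp D₁≠D₂ large₁ large₂
    with covers D₁ D₁-comp | covers D₂ D₂-comp
  ... | i₁ , D₁≡ | i₂ , D₂≡ =
      i₁ , i₂
    , (λ { refl → D₁≠D₂ λ v → trans (D₁≡ v) (sym (D₂≡ v)) })
    , (λ o opt → large₁ o (block-IsOpt-cong (λ v → sym (D₁≡ v)) o opt))
    , (λ o opt → large₂ o (block-IsOpt-cong (λ v → sym (D₂≡ v)) o opt))

  spanning-cycle-node : ∀ {Ĉ} → SpanningCycle (induced G S) Ĉ → Σ (Fin (n G)) λ c → S c ≡ true × V G c ≡ true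
  spanning-cycle-node (_ , cv , _ , _ , _ , cv∈C , _) =
    cv zero , proj₂ (∧-elim (cv∈C zero)) , proj₁ (∧-elim (cv∈C zero))

open import Data.Nat using (ℕ; suc)
open import Data.Fin using (Fin; zero)
open import Data.Bool using (Bool; _∨_)
open import Data.Product using (_×_; _,_)
open import Data.Integer using (+_)
open import Data.Rational using (ℚ; _/_; _≤_)
open import Data.Rational.Properties using (_≤?_)
open import Relation.Binary.PropositionalEquality using (_≡_)
open import Relation.Nullary.Decidable using (decidable-stable)
import Data.Nat as ℕ
import Data.Nat.Properties as ℕP

lemma18 : (α : ℚ) → (+ 5 / 3) ≤ α →
    (G : Graph) → MAP G → TwoNC G →
    (SC : Fin (n G) → Bool) → IsS34 G SC →
    (k : ℕ) (D : Fin k → Fin (suc (n G)) → Bool) →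
    BlockEnum (contract G SC) zero D →
    (F : Fin k → Fin (m G) → Bool) →
    (∀ i → IsECSS (block (contract G SC) zero (D i)) (F i)) →
    (∀ i o → IsOpt (block (contract G SC) zero (D i)) o →
       ℕ→ℚ (costOf G (F i)) ≤ bound α o) →
    (Ĉ : Fin (m G) → Bool) → SpanningCycle (induced G SC) Ĉ → costOf G Ĉ ≡ 2 →
    IsECSS G (λ e → Ĉ e ∨ anyFin (λ i → F i e)) ×
    (∀ o → IsOpt G o →
       ℕ→ℚ (costOf G (λ e → Ĉ e ∨ anyFin (λ i → F i e))) ≤ bound α o)
lemma18 α 5/3≤α G (wfG , _) (three-nodes , _) SC
        (SC⊆V , _ , _ , _ , _ , _ , D₁ , D₂ , D₁-comp , D₂-comp , D₁≠D₂ , large₁ , large₂)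
        k D enum F F-ECSS F-cost Ĉ cycle cost-Ĉ =
  union-ECSS (ℕP.≤-trans (ℕP.n≤1+n 2) three-nodes) SC⊆V D enum F F-ECSS Ĉ cycle , cost-bound
  where
  open Decomposition G wfG SC
  open FiniteSums using (costOf-∨; costOf-anyFin)

  cost-U : costOf G (λ e → Ĉ e ∨ anyFin (λ i → F i e)) ℕ.≤ 2 ℕ.+ sumFin (λ i → costOf G (F i))
  cost-U = ℕP.≤-trans (costOf-∨ G Ĉ _) (ℕP.+-mono-≤ (ℕP.≤-reflexive cost-Ĉ) (costOf-anyFin G F))

  -- the accounting lemma, applied to the optima of the blocks; these
  -- exist up to double negation, which the decidable goal absorbs
  cost-bound : ∀ O → IsOpt G O → ℕ→ℚ (costOf G (λ e → Ĉ e ∨ anyFin (λ i → F i e))) ≤ bound α O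
  cost-bound O opt-G with two-large-blocks D enum D₁ D₂ D₁-comp D₂-comp D₁≠D₂ large₁ large₂
                        | spanning-cycle-node cycle
  ... | i₁ , i₂ , i₁≢i₂ , large-i₁ , large-i₂ | c , c∈S , c∈V =
    decidable-stable (_ ≤? _) λ ¬bound →
      blocks-opt-sum c c∈S c∈V D enum O opt-G λ (o , o-opt , Σo≤O) →
        ¬bound (RationalBounds.accounting 5/3≤α (λ i → costOf G (F i)) o i₁ i₂ i₁≢i₂
                  (large-i₁ (o i₁) (o-opt i₁)) (large-i₂ (o i₂) (o-opt i₂))
                  (λ i → F-cost i (o i) (o-opt i)) _ O cost-U Σo≤O)
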